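{- Let $n\ge 2$ and let $\rho_2^{\mathbb{C}}$ be the complex permutation representation of $S_n$ arising from the action of $S_n$ on ordered pairs $(i_1,i_2)$ of distinct elements of $\{1,\dots,n\}$, given by $\pi\cdot(i_1,i_2)=(\pi(i_1),\pi(i_2))$. For $\pi,\sigma\in S_n$, if $\rho_2^{\mathbb{C}}(\pi)$ and $\rho_2^{\mathbb{C}}(\sigma)$ are similar matrices, then $\pi$ and $\sigma$ are conjugate in $S_n$.
   Context: The permutation representation associated with an action of a group on a finite set $X$ sends a group element to the $|X|\times|X|$ permutation matrix of its action on $X$. -}

module Defs where

open import Level using (Level; suc; _⊔_)
open import Algebra.Bundles using (CommutativeRing)
open import Data.Nat using (ℕ; zero) renaming (suc to sucℕ)
open import Data.Fin using (Fin; _≟_)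
open import Data.Fin.Permutation using (Permutation′; _⟨$⟩ʳ_; _⟨$⟩ˡ_; inverseˡ)
open import Data.List using (List; []; _∷_; foldl)
open import Data.Product using (Σ; ∃; _×_; _,_; proj₁)
open import Relation.Nullary using (¬_; yes; no)
open import Relation.Binary.PropositionalEquality using (_≡_; _≢_; refl; sym; trans; cong)

-- Algebraically closed fields of characteristic 0 (the class containing ℂ)

module RingOps {c ℓ} (R : CommutativeRing c ℓ) where
  open CommutativeRing R
  natCast : ℕ → Carrier
  natCast zero     = 0#
  natCast (sucℕ n) = 1# + natCast n
  -- evaluation (Horner) of the monic polynomial x^k + a₁ x^(k-1) + … + a_k,
  -- coefficients listed from degree k-1 downwards to degree 0
  monicEval : List Carrier → Carrier → Carrier
  monicEval cs x = foldl (λ acc a → acc * x + a) 1# cs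

record ACField₀ (c ℓ : Level) : Set (suc (c ⊔ ℓ)) where
  field
    commutativeRing : CommutativeRing c ℓ
  open CommutativeRing commutativeRing public
  open RingOps commutativeRing public
  field
    0≉1           : ¬ (0# ≈ 1#)
    inverse       : ∀ x → ¬ (x ≈ 0#) → ∃ λ y → x * y ≈ 1#
    characteristic0 : ∀ n → ¬ (natCast (sucℕ n) ≈ 0#)
    algClosed     : ∀ (a : Carrier) (as : List Carrier) →
                    ∃ λ x → monicEval (a ∷ as) x ≈ 0#

Pair₂ : ℕ → Set
Pair₂ n = Σ (Fin n × Fin n) (λ p → proj₁ p ≢ Data.Product.proj₂ p)

act₂ : ∀ {n} → Permutation′ n → Pair₂ n → Pair₂ n
act₂ π ((i , j) , i≢j) =
  ((π ⟨$⟩ʳ i) , (π ⟨$⟩ʳ j)) ,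
  λ e → i≢j (trans (sym (inverseˡ π)) (trans (cong (π ⟨$⟩ˡ_) e) (inverseˡ π)))

Conjugate : ∀ {n} → Permutation′ n → Permutation′ n → Set
Conjugate {n} π σ = ∃ λ (τ : Permutation′ n) →
  ∀ i → σ ⟨$⟩ʳ i ≡ τ ⟨$⟩ʳ (π ⟨$⟩ʳ (τ ⟨$⟩ˡ i))

module Matrices {c ℓ} (K : ACField₀ c ℓ) where
  open ACField₀ K using (Carrier; _≈_; _+_; _*_; 0#; 1#)

  Mat₂ : ℕ → Set c
  Mat₂ n = Pair₂ n → Pair₂ n → Carrier

  sumFin : ∀ {n} → (Fin n → Carrier) → Carrier
  sumFin {zero}   f = 0#
  sumFin {sucℕ n} f = f Data.Fin.zero + sumFin (λ i → f (Data.Fin.suc i))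

  sumPair₂ : ∀ {n} → (Pair₂ n → Carrier) → Carrier
  sumPair₂ f = sumFin (λ i → sumFin (λ j → g i j (i ≟ j)))
    where
    g : ∀ i j → Relation.Nullary.Dec (i ≡ j) → Carrier
    g i j (yes _)   = 0#
    g i j (no i≢j)  = f ((i , j) , i≢j)

  _⊛_ : ∀ {n} → Mat₂ n → Mat₂ n → Mat₂ n
  (A ⊛ B) x y = sumPair₂ (λ z → A x z * B z y)

  pairEq? : ∀ {n} (x y : Pair₂ n) → Relation.Nullary.Dec (proj₁ x ≡ proj₁ y)
  pairEq? ((i , j) , _) ((k , l) , _) with i ≟ k | j ≟ l
  ... | yes refl | yes refl = yes refl
  ... | no i≢k   | _        = no (λ { refl → i≢k refl })
  ... | yes _    | no j≢l   = no (λ { refl → j≢l refl })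

  identity : ∀ {n} → Mat₂ n
  identity x y with pairEq? x y
  ... | yes _ = 1#
  ... | no _  = 0#

  _≋_ : ∀ {n} → Mat₂ n → Mat₂ n → Set ℓ
  A ≋ B = ∀ x y → A x y ≈ B x y

  Similar : ∀ {n} → Mat₂ n → Mat₂ n → Set (c ⊔ ℓ)
  Similar {n} A B = ∃ λ (P : Mat₂ n) → ∃ λ (Q : Mat₂ n) →
    ((P ⊛ Q) ≋ identity) × ((Q ⊛ P) ≋ identity) × ((P ⊛ A) ⊛ Q) ≋ B

  ρ₂ : ∀ {n} → Permutation′ n → Mat₂ n
  ρ₂ π x y with pairEq? (act₂ π y) x
  ... | yes _ = 1#
  ... | no _  = 0#

{-# OPTIONS --safe #-}
module Submission where

-- ρ₂(π) is the permutation matrix of π acting on ordered pairs of distinct points, so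
-- ρ₂(π)ᵏ = ρ₂(πᵏ) has trace f (f − 1), where f is the number of fixed points of πᵏ.  Similar
-- matrices have equal traces of all powers and the characteristic is 0, so f (f − 1) is the same
-- for π and σ for every k.  This determines f up to swapping 0 and 1, and for n ≥ 2 a swap
-- (π without fixed points, σ with exactly one) is refuted by a divisibility count of orbits at
-- the least power at which σ fixes two points.  So πᵏ and σᵏ have equally many fixed points for every k,
-- which pins down the cycle type: the points of least period d, for the least d at which a
-- fixed point appears, can be matched orbit by orbit, and the rest is handled by induction.

open import Defs
open import Level using (Level; 0ℓ)
open import Data.Nat using (ℕ; zero; suc; _≤_; _<_; z≤n; s≤s)
import Data.Nat as ℕ
open import Data.Fin using (Fin; zero; suc; toℕ; fromℕ<; _≟_)
open import Data.Fin.Properties using (any?; 0≢1+n; toℕ-fromℕ<; toℕ<n; toℕ-injective; suc-injective; pigeonhole)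
open import Data.Fin.Permutation using (Permutation′; _⟨$⟩ʳ_; _⟨$⟩ˡ_; permutation)
open import Data.Bool using (true; false; if_then_else_)
open import Data.Empty using (⊥; ⊥-elim)
open import Data.Unit using (⊤; tt)
open import Data.Product using (∃; _×_; _,_; proj₁; proj₂)
import Data.Product as Product
open import Data.Sum using (_⊎_; inj₁; inj₂)
open import Function using (_∘_; id; Injective)
open import Function.Bundles using (Injection)
open import Function.Properties.Inverse using (↔⇒↣)
import Function.Endo.Propositional as Endo
open import Induction.WellFounded using (Acc; acc)
open import Relation.Nullary using (Dec; yes; no; does; ¬_; contradiction; _×-dec_)
open import Relation.Unary using (Pred; Decidable; _⊆_; _∩_; ∁)
open import Relation.Unary.Properties using (_∩?_; ∁?)
open import Relation.Binary.Bundles using (Setoid)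
open import Relation.Binary.Definitions using (tri<; tri≈; tri>)
open import Relation.Binary.PropositionalEquality
  using (_≡_; _≢_; refl; sym; trans; cong; cong₂; cong-app; subst; module ≡-Reasoning)
import Algebra.Properties.Semiring.Sum as SemiringSum
import Algebra.Properties.Semiring.Mult as SemiringMult
import Algebra.Properties.Group as GroupProperties
import Relation.Binary.Reasoning.Setoid as SetoidReasoning

private
  variable
    ℓ₁ ℓ₂ : Level
    n d : ℕ

module Combinatorics where
  open import Data.Nat using (_+_; _*_; _∸_; _%_; _/_; NonZero; >-nonZero)
  open import Data.Nat.Properties
    using (*-suc; _≤?_; *-monoʳ-≤; *-monoˡ-<; ≤-pred; <⇒≢; >⇒≢; ≰⇒>; <-irrefl; _<?_; +-cancelˡ-≡; m<n+m;
           anyUpTo?; +-comm; m+[n∸m]≡n; n<1+n; m<n⇒0<n∸m; <⇒≤; <-cmp; ≤-<-trans; m∸n≤m; ≤-antisym; ≤-trans;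
           ≤-reflexive; +-mono-≤; +-suc; m≤n⇒m≤1+n; m≤n+m; n≤0⇒n≡0; ≮⇒≥; module ≤-Reasoning)
  open import Data.Nat.DivMod using (m≡m%n+[m/n]*n; m%n<n)
  open import Data.Nat.Divisibility using (_∣_; divides; _∣?_; m%n≡0⇒n∣m; _∣0; ∣-refl; ∣m∣n⇒∣m+n; ∣m+n∣m⇒∣n; ∣1⇒≡1)
  open import Data.Nat.Induction using (<-wellFounded)

  count : {P : Pred (Fin n) ℓ₁} → Decidable P → ℕ
  count {n = zero}  P? = 0
  count {n = suc n} P? = (if does (P? zero) then 1 else 0) + count (P? ∘ suc)

  count-mono : {P : Pred (Fin n) ℓ₁} {Q : Pred (Fin n) ℓ₂} (P? : Decidable P) (Q? : Decidable Q) →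
               P ⊆ Q → count P? ≤ count Q?
  count-mono {n = zero}  P? Q? P⊆Q = z≤n
  count-mono {n = suc n} P? Q? P⊆Q with P? zero | Q? zero
  ... | yes _  | yes _  = s≤s (count-mono (P? ∘ suc) (Q? ∘ suc) P⊆Q)
  ... | yes P0 | no ¬Q0 = contradiction (P⊆Q P0) ¬Q0
  ... | no _   | yes _  = m≤n⇒m≤1+n (count-mono (P? ∘ suc) (Q? ∘ suc) P⊆Q)
  ... | no _   | no _   = count-mono (P? ∘ suc) (Q? ∘ suc) P⊆Q

  count-cong : {P : Pred (Fin n) ℓ₁} {Q : Pred (Fin n) ℓ₂} (P? : Decidable P) (Q? : Decidable Q) →
               P ⊆ Q → Q ⊆ P → count P? ≡ count Q?
  count-cong P? Q? P⊆Q Q⊆P = ≤-antisym (count-mono P? Q? P⊆Q) (count-mono Q? P? Q⊆P)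

  count-split : {P : Pred (Fin n) ℓ₁} {Q : Pred (Fin n) ℓ₂} (P? : Decidable P) (Q? : Decidable Q) →
                count P? ≡ count (P? ∩? Q?) + count (P? ∩? ∁? Q?)
  count-split {n = zero}  P? Q? = refl
  count-split {n = suc n} P? Q? with P? zero | Q? zero
  ... | yes _ | yes _ = cong suc (count-split (P? ∘ suc) (Q? ∘ suc))
  ... | yes _ | no _  = trans (cong suc (count-split (P? ∘ suc) (Q? ∘ suc))) (sym (+-suc _ _))
  ... | no _  | _     = count-split (P? ∘ suc) (Q? ∘ suc)

  count>0⇒∃ : {P : Pred (Fin n) ℓ₁} (P? : Decidable P) → 0 < count P? → ∃ P
  count>0⇒∃ {n = suc n} P? pos with P? zero
  ... | yes P0 = zero , P0
  ... | no _   = Product.map suc id (count>0⇒∃ (P? ∘ suc) pos)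

  ∈⇒count>0 : {P : Pred (Fin n) ℓ₁} (P? : Decidable P) {a : Fin n} → P a → 0 < count P?
  ∈⇒count>0 {n = suc n} P? {zero} Pa with P? zero
  ... | yes _   = s≤s z≤n
  ... | no ¬P0  = contradiction Pa ¬P0
  ∈⇒count>0 {n = suc n} P? {suc a} Pa =
    ≤-trans (∈⇒count>0 (P? ∘ suc) Pa) (m≤n+m _ (if does (P? zero) then 1 else 0))

  count-∅ : {P : Pred (Fin n) ℓ₁} (P? : Decidable P) → (∀ {a} → ¬ P a) → count P? ≡ 0
  count-∅ P? ∅ = n≤0⇒n≡0 (≮⇒≥ (∅ ∘ proj₂ ∘ count>0⇒∃ P?))

  count-singleton : (a : Fin n) → count (_≟ a) ≡ 1
  count-singleton {suc n} zero = cong suc (count-∅ {n = n} (λ i → suc i ≟ zero) λ ())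
  count-singleton {suc n} (suc a) =
    trans (count-cong (λ i → suc i ≟ suc a) (_≟ a) suc-injective (cong suc)) (count-singleton a)

  count≥2 : {P : Pred (Fin n) ℓ₁} (P? : Decidable P) {a b : Fin n} → P a → P b → a ≢ b → 2 ≤ count P?
  count≥2 P? {a} {b} Pa Pb a≢b = begin
    1 + 1
      ≤⟨ +-mono-≤ (≤-reflexive (sym at-a)) (∈⇒count>0 (P? ∩? ∁? (_≟ a)) (Pb , a≢b ∘ sym)) ⟩
    count (P? ∩? (_≟ a)) + count (P? ∩? ∁? (_≟ a))
      ≡⟨ count-split P? (_≟ a) ⟨
    count P? ∎
    where
    open ≤-Reasoning
    at-a : count (P? ∩? (_≟ a)) ≡ 1
    at-a = trans (count-cong (P? ∩? (_≟ a)) (_≟ a) proj₂ (λ { refl → Pa , refl })) (count-singleton a)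

  count-image : (g : Fin d → Fin n) → Injective _≡_ _≡_ g → count (λ z → any? (λ j → g j ≟ z)) ≡ d
  count-image {zero} g g-injective = count-∅ (λ z → any? (λ j → g j ≟ z)) λ { (() , _) }
  count-image {suc d} g g-injective = begin
    count Im?                                      ≡⟨ count-split Im? (_≟ g zero) ⟩
    count (Im? ∩? (_≟ g zero)) + count (Im? ∩? ∁? (_≟ g zero))
      ≡⟨ cong₂ _+_ at-g0 (count-cong (Im? ∩? ∁? (_≟ g zero)) Im′? away-from-g0 into-rest) ⟩
    1 + count Im′?                                 ≡⟨ cong suc (count-image (g ∘ suc) (suc-injective ∘ g-injective)) ⟩
    suc d                                          ∎
    where
    open ≡-Reasoning
    Im? : Decidable (λ z → ∃ λ j → g j ≡ z)
    Im? z = any? (λ j → g j ≟ z)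
    Im′? : Decidable (λ z → ∃ λ j → g (suc j) ≡ z)
    Im′? z = any? (λ j → g (suc j) ≟ z)
    at-g0 : count (Im? ∩? (_≟ g zero)) ≡ 1
    at-g0 = trans (count-cong (Im? ∩? (_≟ g zero)) (_≟ g zero) proj₂ (λ { refl → (zero , refl) , refl }))
                  (count-singleton (g zero))
    away-from-g0 : ∀ {z} → (∃ λ j → g j ≡ z) × z ≢ g zero → ∃ λ j → g (suc j) ≡ z
    away-from-g0 ((zero  , refl) , z≢g0) = contradiction refl z≢g0
    away-from-g0 ((suc j , gj≡z) , _)    = j , gj≡z
    into-rest : ∀ {z} → (∃ λ j → g (suc j) ≡ z) → (∃ λ j → g j ≡ z) × z ≢ g zero
    into-rest (j , refl) = (suc j , refl) , λ e → 0≢1+n (sym (g-injective e))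

  ⟨$⟩ʳ-injective : (π : Permutation′ n) → Injective _≡_ _≡_ (π ⟨$⟩ʳ_)
  ⟨$⟩ʳ-injective π = Injection.injective (↔⇒↣ π)

  infixr 8 _^_
  _^_ : (Fin n → Fin n) → ℕ → Fin n → Fin n
  _^_ {n} = Endo._^_ (Fin n)

  Fix : (Fin n → Fin n) → Pred (Fin n) 0ℓ
  Fix f x = f x ≡ x

  fix? : (f : Fin n → Fin n) → Decidable (Fix f)
  fix? f x = f x ≟ x

  fixCount : (Fin n → Fin n) → ℕ
  fixCount f = count (fix? f)

  count-∩-fix⁰ : {U : Pred (Fin n) ℓ₁} (U? : Decidable U) (f : Fin n → Fin n) → count (U? ∩? fix? (f ^ 0)) ≡ count U?
  count-∩-fix⁰ U? f = count-cong (U? ∩? fix? (f ^ 0)) U? proj₁ (_, refl)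

  module Periods {n} (p : Fin n → Fin n) (p-injective : Injective _≡_ _≡_ p) where

    ^-+ : ∀ a b x → (p ^ (a + b)) x ≡ (p ^ a) ((p ^ b) x)
    ^-+ a b = cong-app (Endo.^-homo (Fin n) p a b)

    ^-comm : ∀ a b x → (p ^ a) ((p ^ b) x) ≡ (p ^ b) ((p ^ a) x)
    ^-comm a b x = begin
      (p ^ a) ((p ^ b) x) ≡⟨ ^-+ a b x ⟨
      (p ^ (a + b)) x     ≡⟨ cong (λ k → (p ^ k) x) (+-comm a b) ⟩
      (p ^ (b + a)) x     ≡⟨ ^-+ b a x ⟩
      (p ^ b) ((p ^ a) x) ∎
      where open ≡-Reasoning

    ^-injective : ∀ k → Injective _≡_ _≡_ (p ^ k)
    ^-injective zero    = id
    ^-injective (suc k) = ^-injective k ∘ p-injective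

    Fix⊆Fix^ : ∀ k → Fix p ⊆ Fix (p ^ k)
    Fix⊆Fix^ zero    fixed = refl
    Fix⊆Fix^ (suc k) fixed = trans (cong p (Fix⊆Fix^ k fixed)) fixed

    Fix^-invariant : ∀ k → Fix (p ^ k) ⊆ Fix (p ^ k) ∘ p
    Fix^-invariant k {z} fixed = trans (^-comm k 1 z) (cong p fixed)

    fixCount-mono : ∀ k → fixCount p ≤ fixCount (p ^ k)
    fixCount-mono k = count-mono (fix? p) (fix? (p ^ k)) (Fix⊆Fix^ k)

    fixCount≡1⇒fixed : ∀ k → fixCount (p ^ k) ≡ 1 → 0 < fixCount p
    fixCount≡1⇒fixed k unique with count>0⇒∃ (fix? (p ^ k)) (subst (0 <_) (sym unique) (s≤s z≤n))
    ... | a , a-fixed with p a ≟ a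
    ...   | yes pa≡a = ∈⇒count>0 (fix? p) pa≡a
    ...   | no pa≢a  =
      contradiction unique (>⇒≢ (count≥2 (fix? (p ^ k)) (Fix^-invariant k a-fixed) a-fixed pa≢a))

    ^-*-fixed : ∀ {d x} → (p ^ d) x ≡ x → ∀ m → (p ^ (m * d)) x ≡ x
    ^-*-fixed         fixed zero    = refl
    ^-*-fixed {d} {x} fixed (suc m) = trans (^-+ d (m * d) x) (trans (cong (p ^ d) (^-*-fixed fixed m)) fixed)

    ^-∸-fixed : ∀ {a b x} → a ≤ b → (p ^ a) x ≡ (p ^ b) x → (p ^ (b ∸ a)) x ≡ x
    ^-∸-fixed {a} {b} {x} a≤b e = ^-injective a (begin
      (p ^ a) ((p ^ (b ∸ a)) x) ≡⟨ ^-+ a (b ∸ a) x ⟨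
      (p ^ (a + (b ∸ a))) x     ≡⟨ cong (λ k → (p ^ k) x) (m+[n∸m]≡n a≤b) ⟩
      (p ^ b) x                 ≡⟨ e ⟨
      (p ^ a) x                 ∎)
      where open ≡-Reasoning

    period : ∀ x → ∃ λ k → 0 < k × (p ^ k) x ≡ x
    period x with pigeonhole (n<1+n n) (λ (j : Fin (suc n)) → (p ^ toℕ j) x)
    ... | i , j , i<j , e = toℕ j ∸ toℕ i , m<n⇒0<n∸m i<j , ^-∸-fixed (<⇒≤ i<j) e

    record LeastPeriod (d : ℕ) (x : Fin n) : Set where
      field
        positive : 0 < d
        periodic : (p ^ d) x ≡ x
        least    : ∀ {e} → 0 < e → e < d → (p ^ e) x ≢ x

      instance
        d-nonZero : NonZero d
        d-nonZero = >-nonZero positive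

      ^-mod : ∀ k .{{_ : NonZero d}} → (p ^ k) x ≡ (p ^ (k % d)) x
      ^-mod k = begin
        (p ^ k) x                               ≡⟨ cong (λ e → (p ^ e) x) (m≡m%n+[m/n]*n k d) ⟩
        (p ^ (k % d + k / d * d)) x             ≡⟨ ^-+ (k % d) (k / d * d) x ⟩
        (p ^ (k % d)) ((p ^ (k / d * d)) x)     ≡⟨ cong (p ^ (k % d)) (^-*-fixed periodic (k / d)) ⟩
        (p ^ (k % d)) x                         ∎
        where open ≡-Reasoning

      fixed⇒∣ : ∀ {k} → (p ^ k) x ≡ x → d ∣ k
      fixed⇒∣ {k} fixed with k % d in k%d≡r
      ... | zero  = m%n≡0⇒n∣m k d k%d≡r
      ... | suc r = contradiction (trans (subst (λ e → (p ^ e) x ≡ (p ^ k) x) k%d≡r (sym (^-mod k))) fixed)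
                                  (least (s≤s z≤n) (subst (_< d) k%d≡r (m%n<n k d)))

      ∣⇒fixed : ∀ {k} → d ∣ k → (p ^ k) x ≡ x
      ∣⇒fixed (divides m refl) = ^-*-fixed periodic m

      index-injective : ∀ {a b} → a < d → b < d → (p ^ a) x ≡ (p ^ b) x → a ≡ b
      index-injective {a} {b} a<d b<d e with <-cmp a b
      ... | tri≈ _ a≡b _ = a≡b
      ... | tri< a<b _ _ = contradiction (^-∸-fixed (<⇒≤ a<b) e)
                                         (least (m<n⇒0<n∸m a<b) (≤-<-trans (m∸n≤m b a) b<d))
      ... | tri> _ _ b<a = contradiction (^-∸-fixed (<⇒≤ b<a) (sym e))
                                         (least (m<n⇒0<n∸m b<a) (≤-<-trans (m∸n≤m a b) a<d))

    Orbit : ℕ → Fin n → Pred (Fin n) 0ℓ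
    Orbit d x z = ∃ λ (j : Fin d) → (p ^ toℕ j) x ≡ z

    orbit? : ∀ d x → Decidable (Orbit d x)
    orbit? d x z = any? (λ j → (p ^ toℕ j) x ≟ z)

    module Orbits {d x} (lp : LeastPeriod d x) where
      open LeastPeriod lp

      orbit-∋ : ∀ k → Orbit d x ((p ^ k) x)
      orbit-∋ k =
        fromℕ< (m%n<n k d) , trans (cong (λ j → (p ^ j) x) (toℕ-fromℕ< (m%n<n k d))) (sym (^-mod k))

      Orbit-invariant : Orbit d x ⊆ Orbit d x ∘ p
      Orbit-invariant (j , refl) = orbit-∋ (suc (toℕ j))

      Orbit-coinvariant : Orbit d x ∘ p ⊆ Orbit d x
      Orbit-coinvariant {z} (j , pʲx≡pz) =
        subst (Orbit d x) (p-injective shifted) (orbit-∋ (toℕ j + (d ∸ 1)))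
        where
        open ≡-Reasoning
        shifted : p ((p ^ (toℕ j + (d ∸ 1))) x) ≡ p z
        shifted = begin
          (p ^ suc (toℕ j + (d ∸ 1))) x  ≡⟨ cong (λ k → (p ^ k) x) (sym (+-suc (toℕ j) (d ∸ 1))) ⟩
          (p ^ (toℕ j + suc (d ∸ 1))) x  ≡⟨ cong (λ k → (p ^ (toℕ j + k)) x) (m+[n∸m]≡n positive) ⟩
          (p ^ (toℕ j + d)) x            ≡⟨ ^-+ (toℕ j) d x ⟩
          (p ^ toℕ j) ((p ^ d) x)        ≡⟨ cong (p ^ toℕ j) periodic ⟩
          (p ^ toℕ j) x                  ≡⟨ pʲx≡pz ⟩
          p z                            ∎

      Orbit⊆ : {U : Pred (Fin n) ℓ₁} → U ⊆ U ∘ p → U x → Orbit d x ⊆ U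
      Orbit⊆ {U = U} U-invariant Ux (j , refl) = iterate (toℕ j)
        where
        iterate : ∀ k → U ((p ^ k) x)
        iterate zero    = Ux
        iterate (suc k) = U-invariant (iterate k)

      orbit-leastPeriod : ∀ {z} → Orbit d x z → LeastPeriod d z
      orbit-leastPeriod (j , refl) = record
        { positive = positive
        ; periodic = trans (^-comm d (toℕ j) x) (cong (p ^ toℕ j) periodic)
        ; least    = λ {e} e>0 e<d fixed →
                       least e>0 e<d (^-injective (toℕ j) (trans (^-comm (toℕ j) e x) fixed))
        }

      orbit-count : count (orbit? d x) ≡ d
      orbit-count =
        count-image (λ j → (p ^ toℕ j) x) (toℕ-injective ∘ index-injective (toℕ<n _) (toℕ<n _))

      orbit-fixCount : ∀ k → count (orbit? d x ∩? fix? (p ^ k)) ≡ (if does (d ∣? k) then d else 0)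
      orbit-fixCount k with d ∣? k
      ... | yes d∣k = trans (count-cong (orbit? d x ∩? fix? (p ^ k)) (orbit? d x) proj₁
                                        (λ o → o , LeastPeriod.∣⇒fixed (orbit-leastPeriod o) d∣k))
                            orbit-count
      ... | no d∤k  = count-∅ (orbit? d x ∩? fix? (p ^ k))
                              λ (o , fixed) → d∤k (LeastPeriod.fixed⇒∣ (orbit-leastPeriod o) fixed)

      removeOrbit-invariant : {U : Pred (Fin n) ℓ₁} → U ⊆ U ∘ p →
                              U ∩ ∁ (Orbit d x) ⊆ (U ∩ ∁ (Orbit d x)) ∘ p
      removeOrbit-invariant U-invariant (Uz , z∉O) = U-invariant Uz , z∉O ∘ Orbit-coinvariant

      count-removeOrbit : {U : Pred (Fin n) ℓ₁} (U? : Decidable U) → U ⊆ U ∘ p → U x →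
                          count U? ≡ d + count (U? ∩? ∁? (orbit? d x))
      count-removeOrbit U? U-invariant Ux = trans (count-split U? (orbit? d x)) (cong (_+ count (U? ∩? ∁? (orbit? d x)))
        (trans (count-cong (U? ∩? orbit? d x) (orbit? d x) proj₂ (λ o → Orbit⊆ U-invariant Ux o , o)) orbit-count))

      count-∩-removeOrbit : {U : Pred (Fin n) ℓ₁} {W : Pred (Fin n) ℓ₂} (U? : Decidable U) (W? : Decidable W) →
                            U ⊆ U ∘ p → U x →
                            count (U? ∩? W?) ≡ count (orbit? d x ∩? W?) + count ((U? ∩? ∁? (orbit? d x)) ∩? W?)
      count-∩-removeOrbit U? W? U-invariant Ux = trans (count-split (U? ∩? W?) (orbit? d x)) (cong₂ _+_
        (count-cong ((U? ∩? W?) ∩? orbit? d x) (orbit? d x ∩? W?)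
                    (λ ((_ , w) , o) → o , w) (λ (o , w) → (Orbit⊆ U-invariant Ux o , w) , o))
        (count-cong ((U? ∩? W?) ∩? ∁? (orbit? d x)) ((U? ∩? ∁? (orbit? d x)) ∩? W?)
                    (λ ((u , w) , o∉) → (u , o∉) , w) (λ ((u , o∉) , w) → (u , w) , o∉)))

    leastPeriod-∣-count : ∀ {d} {U : Pred (Fin n) 0ℓ} (U? : Decidable U) → U ⊆ U ∘ p →
                          (∀ {z} → U z → LeastPeriod d z) → d ∣ count U?
    leastPeriod-∣-count U? U-invariant U-period = go U? U-invariant U-period (<-wellFounded (count U?))
      where
      go : ∀ {d} {U : Pred (Fin n) 0ℓ} (U? : Decidable U) → U ⊆ U ∘ p →
           (∀ {z} → U z → LeastPeriod d z) → Acc _<_ (count U?) → d ∣ count U?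
      go {d} {U} U? U-invariant U-period (acc smaller) with any? U?
      ... | no ∄U        = subst (d ∣_) (sym (count-∅ U? λ Uz → ∄U (_ , Uz))) (d ∣0)
      ... | yes (x , Ux) = subst (d ∣_) (sym removed)
        (∣m∣n⇒∣m+n ∣-refl (go (U? ∩? ∁? (orbit? d x)) (removeOrbit-invariant {U = U} U-invariant)
                              (U-period ∘ proj₁) (smaller decreasing)))
        where
        open Orbits (U-period Ux)
        removed : count U? ≡ d + count (U? ∩? ∁? (orbit? d x))
        removed = count-removeOrbit U? U-invariant Ux
        decreasing : count (U? ∩? ∁? (orbit? d x)) < count U?
        decreasing = subst (count (U? ∩? ∁? (orbit? d x)) <_) (sym removed)
                           (m<n+m _ (LeastPeriod.positive (U-period Ux)))

  minimal : {P : Pred ℕ ℓ₁} → Decidable P → ∀ {k} → P k → ∃ λ d → P d × (∀ {e} → e < d → ¬ P e)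
  minimal {P = P} P? {k} Pk = go (<-wellFounded k) Pk
    where
    go : ∀ {k} → Acc _<_ k → P k → ∃ λ d → P d × (∀ {e} → e < d → ¬ P e)
    go {k} (acc smaller) Pk with anyUpTo? P? k
    ... | yes (e , e<k , Pe) = go (smaller e<k) Pe
    ... | no none            = k , Pk , λ e<k Pe → none (_ , e<k , Pe)

  module OrbitMap {n} {p q : Fin n → Fin n}
                  (p-injective : Injective _≡_ _≡_ p) (q-injective : Injective _≡_ _≡_ q) {d x y}
                  (x-period : Periods.LeastPeriod p p-injective d x)
                  (y-period : Periods.LeastPeriod q q-injective d y) where
    open Periods p p-injective using (orbit?; module Orbits)
    open Orbits x-period using (orbit-∋)
    module X = Periods.LeastPeriod x-period
    module Y = Periods.LeastPeriod y-period
    open X using (d-nonZero)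

    transfer : ∀ a b → (p ^ a) x ≡ (p ^ b) x → (q ^ a) y ≡ (q ^ b) y
    transfer a b e = begin
      (q ^ a) y        ≡⟨ Y.^-mod a ⟩
      (q ^ (a % d)) y  ≡⟨ cong (λ k → (q ^ k) y) same-residue ⟩
      (q ^ (b % d)) y  ≡⟨ Y.^-mod b ⟨
      (q ^ b) y        ∎
      where
      open ≡-Reasoning
      same-residue : a % d ≡ b % d
      same-residue =
        X.index-injective (m%n<n a d) (m%n<n b d) (trans (sym (X.^-mod a)) (trans e (X.^-mod b)))

    orbitMap : Fin n → Fin n
    orbitMap z with orbit? d x z
    ... | yes (j , _) = (q ^ toℕ j) y
    ... | no _        = z

    orbitMap-^ : ∀ k → orbitMap ((p ^ k) x) ≡ (q ^ k) y
    orbitMap-^ k with orbit? d x ((p ^ k) x)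
    ... | yes (j , pʲx≡pᵏx) = transfer (toℕ j) k pʲx≡pᵏx
    ... | no ∉O             = contradiction (orbit-∋ k) ∉O

  module Conjugacies {n} {p q : Fin n → Fin n}
                     (p-injective : Injective _≡_ _≡_ p) (q-injective : Injective _≡_ _≡_ q) where
    module P = Periods p p-injective
    module Q = Periods q q-injective

    record Conjugacy (U V : Pred (Fin n) 0ℓ) : Set where
      field
        to from : Fin n → Fin n
        to-∈    : ∀ {z} → U z → V (to z)
        from-∈  : ∀ {w} → V w → U (from w)
        from-to : ∀ {z} → U z → from (to z) ≡ z
        to-from : ∀ {w} → V w → to (from w) ≡ w
        to-comm : ∀ {z} → U z → to (p z) ≡ q (to z)

    emptyConjugacy : {U V : Pred (Fin n) 0ℓ} → (∀ {z} → ¬ U z) → (∀ {w} → ¬ V w) → Conjugacy U V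
    emptyConjugacy ∅U ∅V = record
      { to = id ; from = id
      ; to-∈ = λ Uz → ⊥-elim (∅U Uz) ; from-∈ = λ Vw → ⊥-elim (∅V Vw)
      ; from-to = λ Uz → ⊥-elim (∅U Uz) ; to-from = λ Vw → ⊥-elim (∅V Vw)
      ; to-comm = λ Uz → ⊥-elim (∅U Uz)
      }

    orbitConjugacy : ∀ {d x y} → P.LeastPeriod d x → Q.LeastPeriod d y → Conjugacy (P.Orbit d x) (Q.Orbit d y)
    orbitConjugacy x-period y-period = record
      { to      = X→Y.orbitMap
      ; from    = Y→X.orbitMap
      ; to-∈    = λ { (j , refl) → j , sym (X→Y.orbitMap-^ (toℕ j)) }
      ; from-∈  = λ { (j , refl) → j , sym (Y→X.orbitMap-^ (toℕ j)) }
      ; from-to = λ { (j , refl) →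
                      trans (cong Y→X.orbitMap (X→Y.orbitMap-^ (toℕ j))) (Y→X.orbitMap-^ (toℕ j)) }
      ; to-from = λ { (j , refl) →
                      trans (cong X→Y.orbitMap (Y→X.orbitMap-^ (toℕ j))) (X→Y.orbitMap-^ (toℕ j)) }
      ; to-comm = λ { (j , refl) →
                      trans (X→Y.orbitMap-^ (suc (toℕ j))) (cong q (sym (X→Y.orbitMap-^ (toℕ j)))) }
      }
      where
      module X→Y = OrbitMap p-injective q-injective x-period y-period
      module Y→X = OrbitMap q-injective p-injective y-period x-period

    union : {U V A B : Pred (Fin n) 0ℓ} (A? : Decidable A) (B? : Decidable B) → A ⊆ U → B ⊆ V →
            A ⊆ A ∘ p → A ∘ p ⊆ A → Conjugacy A B → Conjugacy (U ∩ ∁ A) (V ∩ ∁ B) → Conjugacy U V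
    union {U} {V} {A} {B} A? B? A⊆U B⊆V A-invariant A-coinvariant inner outer = record
      { to = to ; from = from ; to-∈ = to-∈ ; from-∈ = from-∈
      ; from-to = from-to ; to-from = to-from ; to-comm = to-comm
      }
      where
      module I = Conjugacy inner
      module O = Conjugacy outer

      to : Fin n → Fin n
      to z with A? z
      ... | yes _ = I.to z
      ... | no _  = O.to z

      from : Fin n → Fin n
      from w with B? w
      ... | yes _ = I.from w
      ... | no _  = O.from w

      to-∈ : ∀ {z} → U z → V (to z)
      to-∈ {z} Uz with A? z
      ... | yes Az = B⊆V (I.to-∈ Az)
      ... | no ∉A  = proj₁ (O.to-∈ (Uz , ∉A))

      from-∈ : ∀ {w} → V w → U (from w)
      from-∈ {w} Vw with B? w
      ... | yes Bw = A⊆U (I.from-∈ Bw)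
      ... | no ∉B  = proj₁ (O.from-∈ (Vw , ∉B))

      from-to : ∀ {z} → U z → from (to z) ≡ z
      from-to {z} Uz with A? z
      ... | yes Az with B? (I.to z)
      ...   | yes _ = I.from-to Az
      ...   | no ∉B = contradiction (I.to-∈ Az) ∉B
      from-to {z} Uz | no ∉A with B? (O.to z)
      ...   | yes B-Oz = contradiction B-Oz (proj₂ (O.to-∈ (Uz , ∉A)))
      ...   | no _     = O.from-to (Uz , ∉A)

      to-from : ∀ {w} → V w → to (from w) ≡ w
      to-from {w} Vw with B? w
      ... | yes Bw with A? (I.from w)
      ...   | yes _ = I.to-from Bw
      ...   | no ∉A = contradiction (I.from-∈ Bw) ∉A
      to-from {w} Vw | no ∉B with A? (O.from w)
      ...   | yes A-Ow = contradiction A-Ow (proj₂ (O.from-∈ (Vw , ∉B)))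
      ...   | no _     = O.to-from (Vw , ∉B)

      to-comm : ∀ {z} → U z → to (p z) ≡ q (to z)
      to-comm {z} Uz with A? z | A? (p z)
      ... | yes Az | yes _   = I.to-comm Az
      ... | yes Az | no ∉A   = contradiction (A-invariant Az) ∉A
      ... | no ∉A  | yes Apz = contradiction (A-coinvariant Apz) ∉A
      ... | no ∉A  | no _    = O.to-comm (Uz , ∉A)

    SameFixCounts : {U V : Pred (Fin n) 0ℓ} → Decidable U → Decidable V → Set
    SameFixCounts U? V? = ∀ k → count (U? ∩? fix? (p ^ k)) ≡ count (V? ∩? fix? (q ^ k))

    power-with-fixed-point? : {U : Pred (Fin n) 0ℓ} (U? : Decidable U) →
                              Decidable (λ k → 0 < k × 0 < count (U? ∩? fix? (p ^ k)))
    power-with-fixed-point? U? k = 0 <? k ×-dec 0 <? count (U? ∩? fix? (p ^ k))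

    -- d is the least power of p with a fixed point in U.  A fixed point in U of a smaller power of p,
    -- or (by SameFixCounts) in V of a smaller power of q, would contradict minimality, so x and y
    -- have least period d.
    matchingPoints : {U V : Pred (Fin n) 0ℓ} (U? : Decidable U) (V? : Decidable V) → ∀ {x₀} → U x₀ →
                     SameFixCounts U? V? → ∃ λ d → ∃ λ x → ∃ λ y → U x × V y × P.LeastPeriod d x × Q.LeastPeriod d y
    matchingPoints U? V? {x₀} Ux₀ same with P.period x₀
    ... | k₀ , k₀>0 , x₀-fixed
      with minimal (power-with-fixed-point? U?) (k₀>0 , ∈⇒count>0 (U? ∩? fix? (p ^ k₀)) (Ux₀ , x₀-fixed))
    ... | d , (d>0 , U-fixed) , below
      with count>0⇒∃ (U? ∩? fix? (p ^ d)) U-fixed | count>0⇒∃ (V? ∩? fix? (q ^ d)) (subst (0 <_) (same d) U-fixed)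
    ... | x , Ux , x-fixed | y , Vy , y-fixed = d , x , y , Ux , Vy ,
      record { positive = d>0 ; periodic = x-fixed
             ; least = λ {e} e>0 e<d fixed → below e<d (e>0 , ∈⇒count>0 (U? ∩? fix? (p ^ e)) (Ux , fixed)) } ,
      record { positive = d>0 ; periodic = y-fixed
             ; least = λ {e} e>0 e<d fixed →
                 below e<d (e>0 , subst (0 <_) (sym (same e)) (∈⇒count>0 (V? ∩? fix? (q ^ e)) (Vy , fixed))) }

    removeOrbits-sameFixCounts : ∀ {U V : Pred (Fin n) 0ℓ} {d x y} (U? : Decidable U) (V? : Decidable V) →
      (x-period : P.LeastPeriod d x) (y-period : Q.LeastPeriod d y) → U ⊆ U ∘ p → V ⊆ V ∘ q → U x → V y →
      SameFixCounts U? V? → SameFixCounts (U? ∩? ∁? (P.orbit? d x)) (V? ∩? ∁? (Q.orbit? d y))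
    removeOrbits-sameFixCounts {d = d} {x} {y} U? V? x-period y-period U-invariant V-invariant Ux Vy same k =
      +-cancelˡ-≡ (count (P.orbit? d x ∩? fix? (p ^ k))) _ _ (begin
        count (P.orbit? d x ∩? fix? (p ^ k)) + count ((U? ∩? ∁? (P.orbit? d x)) ∩? fix? (p ^ k))
          ≡⟨ X.count-∩-removeOrbit U? (fix? (p ^ k)) U-invariant Ux ⟨
        count (U? ∩? fix? (p ^ k))
          ≡⟨ same k ⟩
        count (V? ∩? fix? (q ^ k))
          ≡⟨ Y.count-∩-removeOrbit V? (fix? (q ^ k)) V-invariant Vy ⟩
        count (Q.orbit? d y ∩? fix? (q ^ k)) + count ((V? ∩? ∁? (Q.orbit? d y)) ∩? fix? (q ^ k))
          ≡⟨ cong (_+ count ((V? ∩? ∁? (Q.orbit? d y)) ∩? fix? (q ^ k)))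
                  (trans (Y.orbit-fixCount k) (sym (X.orbit-fixCount k))) ⟩
        count (P.orbit? d x ∩? fix? (p ^ k)) + count ((V? ∩? ∁? (Q.orbit? d y)) ∩? fix? (q ^ k)) ∎)
      where
      open ≡-Reasoning
      module X = P.Orbits x-period
      module Y = Q.Orbits y-period

    conjugacy : {U V : Pred (Fin n) 0ℓ} (U? : Decidable U) (V? : Decidable V) → U ⊆ U ∘ p → V ⊆ V ∘ q →
                SameFixCounts U? V? → Conjugacy U V
    conjugacy U? V? U-invariant V-invariant same = go U? V? U-invariant V-invariant same (<-wellFounded (count U?))
      where
      go : {U V : Pred (Fin n) 0ℓ} (U? : Decidable U) (V? : Decidable V) → U ⊆ U ∘ p → V ⊆ V ∘ q →
           SameFixCounts U? V? → Acc _<_ (count U?) → Conjugacy U V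
      go {U} {V} U? V? U-invariant V-invariant same (acc smaller) with any? U?
      ... | no ∄U = emptyConjugacy (λ Uz → ∄U (_ , Uz)) λ Vw → <-irrefl (sym V-empty) (∈⇒count>0 V? Vw)
        where
        V-empty : count V? ≡ 0
        V-empty = begin
          count V?                      ≡⟨ count-∩-fix⁰ V? q ⟨
          count (V? ∩? fix? (q ^ 0))    ≡⟨ same 0 ⟨
          count (U? ∩? fix? (p ^ 0))    ≡⟨ count-∩-fix⁰ U? p ⟩
          count U?                      ≡⟨ count-∅ U? (λ Uz → ∄U (_ , Uz)) ⟩
          0                             ∎
          where open ≡-Reasoning
      ... | yes (x₀ , Ux₀) with matchingPoints U? V? Ux₀ same
      ...   | d , x , y , Ux , Vy , x-period , y-period =
        union (P.orbit? d x) (Q.orbit? d y) (X.Orbit⊆ U-invariant Ux) (Y.Orbit⊆ V-invariant Vy)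
              X.Orbit-invariant X.Orbit-coinvariant (orbitConjugacy x-period y-period)
              (go (U? ∩? ∁? (P.orbit? d x)) (V? ∩? ∁? (Q.orbit? d y))
                  (X.removeOrbit-invariant {U = U} U-invariant) (Y.removeOrbit-invariant {U = V} V-invariant)
                  (removeOrbits-sameFixCounts U? V? x-period y-period U-invariant V-invariant Ux Vy same)
                  (smaller decreasing))
        where
        module X = P.Orbits x-period
        module Y = Q.Orbits y-period
        decreasing : count (U? ∩? ∁? (P.orbit? d x)) < count U?
        decreasing = subst (count (U? ∩? ∁? (P.orbit? d x)) <_) (sym (X.count-removeOrbit U? U-invariant Ux))
                           (m<n+m _ (P.LeastPeriod.positive x-period))

    conjugator : (∀ k → fixCount (p ^ k) ≡ fixCount (q ^ k)) →
                 ∃ λ (τ : Permutation′ n) → ∀ i → q i ≡ τ ⟨$⟩ʳ p (τ ⟨$⟩ˡ i)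
    conjugator same = permutation to from (λ _ → to-from tt) (λ _ → from-to tt) ,
                      λ i → trans (cong q (sym (to-from tt))) (sym (to-comm tt))
      where
      everything? : Decidable {A = Fin n} (λ _ → ⊤)
      everything? _ = yes tt
      same′ : SameFixCounts everything? everything?
      same′ k = begin
        count (everything? ∩? fix? (p ^ k))  ≡⟨ count-cong (everything? ∩? fix? (p ^ k)) (fix? (p ^ k)) proj₂ (tt ,_) ⟩
        fixCount (p ^ k)                     ≡⟨ same k ⟩
        fixCount (q ^ k)                     ≡⟨ count-cong (fix? (q ^ k)) (everything? ∩? fix? (q ^ k)) (tt ,_) proj₂ ⟩
        count (everything? ∩? fix? (q ^ k))  ∎
        where open ≡-Reasoning
      open Conjugacy (conjugacy everything? everything? _ _ same′)

  pairCount : ℕ → ℕ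
  pairCount a = a * (a ∸ 1)

  pairCount-+ : ∀ a → pairCount a + a ≡ a * a
  pairCount-+ zero    = refl
  pairCount-+ (suc a) = trans (+-comm (suc a * a) (suc a)) (sym (*-suc (suc a) a))

  pairCount-< : ∀ {a b} → a < b → 2 ≤ b → pairCount a < pairCount b
  pairCount-< {a} {suc zero}    _   (s≤s ())
  pairCount-< {a} {suc (suc b)} a<b _ = begin-strict
    a * (a ∸ 1)          ≤⟨ *-monoʳ-≤ a (≤-trans (m∸n≤m a 1) (≤-pred a<b)) ⟩
    a * suc b            <⟨ *-monoˡ-< (suc b) a<b ⟩
    suc (suc b) * suc b  ∎
    where open ≤-Reasoning

  pairCount-collision-< : ∀ {a b} → a < b → pairCount a ≡ pairCount b → a ≡ 0 × b ≡ 1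
  pairCount-collision-< {zero}  {suc zero}    _        _    = refl , refl
  pairCount-collision-< {suc a} {suc zero}    (s≤s ()) _
  pairCount-collision-< {a}     {suc (suc b)} a<b      same =
    contradiction same (<⇒≢ (pairCount-< a<b (s≤s (s≤s z≤n))))

  pairCount-collision : ∀ {a b} → pairCount a ≡ pairCount b → a ≡ b ⊎ (a ≡ 0 × b ≡ 1) ⊎ (a ≡ 1 × b ≡ 0)
  pairCount-collision {a} {b} same with <-cmp a b
  ... | tri≈ _ a≡b _ = inj₁ a≡b
  ... | tri< a<b _ _ = inj₂ (inj₁ (pairCount-collision-< a<b same))
  ... | tri> _ _ b<a = inj₂ (inj₂ (Product.swap (pairCount-collision-< b<a (sym same))))

  SamePairCounts : (p q : Fin n → Fin n) → Set
  SamePairCounts p q = ∀ k → pairCount (fixCount (p ^ k)) ≡ pairCount (fixCount (q ^ k))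

  unique-vs-none : ∀ {p q : Fin n → Fin n} → Injective _≡_ _≡_ p → Injective _≡_ _≡_ q → ∀ k →
                   fixCount (p ^ k) ≡ 1 → fixCount (q ^ k) ≡ 0 → fixCount p ≡ fixCount q → ⊥
  unique-vs-none {p = p} {q} p-injective q-injective k unique none same-at-1 = <-irrefl (sym none) (begin-strict
    0               <⟨ Periods.fixCount≡1⇒fixed p p-injective k unique ⟩
    fixCount p      ≡⟨ same-at-1 ⟩
    fixCount q      ≤⟨ Periods.fixCount-mono q q-injective k ⟩
    fixCount (q ^ k) ∎)
    where open ≤-Reasoning

  another : 2 ≤ n → (z : Fin n) → ∃ λ x → x ≢ z
  another {suc zero}    (s≤s ()) _
  another {suc (suc n)} _ zero    = suc zero , λ ()
  another {suc (suc n)} _ (suc z) = zero , λ ()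

  -- Let d be the least power at which q has two fixed points.  Below d, q^e fixes only the fixed
  -- point z₀ of q and p^e fixes nothing, so the points fixed by p^d, and those other than z₀ fixed
  -- by q^d, all have least period d.  As fixCount (p ^ d) ≡ fixCount (q ^ d), counting orbits shows
  -- that d divides both this number and its predecessor, so d ≡ 1, contradicting fixCount q ≡ 1.
  fixed-point-free-vs-one : 2 ≤ n → ∀ {p q : Fin n → Fin n} →
    Injective _≡_ _≡_ p → Injective _≡_ _≡_ q → SamePairCounts p q → fixCount p ≡ 0 → fixCount q ≡ 1 → ⊥
  fixed-point-free-vs-one n≥2 {p} {q} p-injective q-injective same p-free q-one
    with count>0⇒∃ (fix? q) (subst (0 <_) (sym q-one) (s≤s z≤n))
  ... | z₀ , z₀-fixed with another n≥2 z₀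
  ... | x , x≢z₀ with Periods.period q q-injective x
  ... | k₀ , k₀>0 , x-fixed
    with minimal (λ k → 0 <? k ×-dec 2 ≤? fixCount (q ^ k))
                 (k₀>0 , count≥2 (fix? (q ^ k₀)) x-fixed (Periods.Fix⊆Fix^ q q-injective k₀ z₀-fixed) x≢z₀)
  ... | d , (d>0 , twice-fixed) , below = <-irrefl (sym q-one) (subst (λ k → 1 < fixCount (q ^ k)) d≡1 twice-fixed)
    where
    module P = Periods p p-injective
    module Q = Periods q q-injective

    q-below : ∀ {e} → 0 < e → e < d → fixCount (q ^ e) ≡ 1
    q-below {e} e>0 e<d = ≤-antisym (≤-pred (≰⇒> λ twice → below e<d (e>0 , twice)))
                                    (subst (_≤ fixCount (q ^ e)) q-one (Q.fixCount-mono e))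

    p-below : ∀ {e} → 0 < e → e < d → fixCount (p ^ e) ≡ 0
    p-below {e} e>0 e<d with pairCount-collision (same e)
    ... | inj₁ F≡G              = contradiction (P.fixCount≡1⇒fixed e (trans F≡G (q-below e>0 e<d)))
                                                (<-irrefl (sym p-free))
    ... | inj₂ (inj₁ (F≡0 , _)) = F≡0
    ... | inj₂ (inj₂ (F≡1 , _)) = contradiction (P.fixCount≡1⇒fixed e F≡1) (<-irrefl (sym p-free))

    equal-at-d : fixCount (p ^ d) ≡ fixCount (q ^ d)
    equal-at-d with pairCount-collision (same d)
    ... | inj₁ F≡G              = F≡G
    ... | inj₂ (inj₁ (_ , G≡1)) = contradiction (subst (1 <_) G≡1 twice-fixed) (<-irrefl refl)
    ... | inj₂ (inj₂ (_ , G≡0)) = contradiction (subst (1 <_) G≡0 twice-fixed) λ ()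

    d∣p-fixed : d ∣ fixCount (p ^ d)
    d∣p-fixed = P.leastPeriod-∣-count (fix? (p ^ d)) (P.Fix^-invariant d) λ fixed → record
      { positive = d>0
      ; periodic = fixed
      ; least    = λ {e} e>0 e<d fixed′ → >⇒≢ (∈⇒count>0 (fix? (p ^ e)) fixed′) (p-below e>0 e<d)
      }

    W? : Decidable (Fix (q ^ d) ∩ ∁ (_≡ z₀))
    W? = fix? (q ^ d) ∩? ∁? (_≟ z₀)

    d∣W : d ∣ count W?
    d∣W = Q.leastPeriod-∣-count W? W-invariant λ (fixed , z≢z₀) → record
      { positive = d>0
      ; periodic = fixed
      ; least    = λ {e} e>0 e<d fixed′ →
          >⇒≢ (count≥2 (fix? (q ^ e)) fixed′ (Q.Fix⊆Fix^ e z₀-fixed) z≢z₀) (q-below e>0 e<d)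
      }
      where
      W-invariant : Fix (q ^ d) ∩ ∁ (_≡ z₀) ⊆ (Fix (q ^ d) ∩ ∁ (_≡ z₀)) ∘ q
      W-invariant (fixed , z≢z₀) =
        Q.Fix^-invariant d fixed , λ qz≡z₀ → z≢z₀ (q-injective (trans qz≡z₀ (sym z₀-fixed)))

    q-fixed≡1+W : fixCount (q ^ d) ≡ 1 + count W?
    q-fixed≡1+W = trans (count-split (fix? (q ^ d)) (_≟ z₀)) (cong (_+ count W?)
      (trans (count-cong (fix? (q ^ d) ∩? (_≟ z₀)) (_≟ z₀) proj₂ (λ { refl → Q.Fix⊆Fix^ d z₀-fixed , refl }))
             (count-singleton z₀)))

    d≡1 : d ≡ 1
    d≡1 = ∣1⇒≡1 (∣m+n∣m⇒∣n (subst (d ∣_) (trans equal-at-d (trans q-fixed≡1+W (+-comm 1 (count W?)))) d∣p-fixed)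
                            d∣W)

  fixCount-at-1 : 2 ≤ n → ∀ {p q : Fin n → Fin n} → Injective _≡_ _≡_ p → Injective _≡_ _≡_ q →
                  SamePairCounts p q → fixCount p ≡ fixCount q
  fixCount-at-1 n≥2 p-injective q-injective same with pairCount-collision (same 1)
  ... | inj₁ F≡G              = F≡G
  ... | inj₂ (inj₁ (F≡0 , G≡1)) = ⊥-elim (fixed-point-free-vs-one n≥2 p-injective q-injective same F≡0 G≡1)
  ... | inj₂ (inj₂ (F≡1 , G≡0)) = ⊥-elim (fixed-point-free-vs-one n≥2 q-injective p-injective (sym ∘ same) G≡0 F≡1)

  fixCounts-equal : 2 ≤ n → ∀ {p q : Fin n → Fin n} → Injective _≡_ _≡_ p → Injective _≡_ _≡_ q →
                    SamePairCounts p q → ∀ k → fixCount (p ^ k) ≡ fixCount (q ^ k)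
  fixCounts-equal n≥2 p-injective q-injective same k
    with pairCount-collision (same k) | fixCount-at-1 n≥2 p-injective q-injective same
  ... | inj₁ F≡G                | _    = F≡G
  ... | inj₂ (inj₁ (F≡0 , G≡1)) | at-1 = ⊥-elim (unique-vs-none q-injective p-injective k G≡1 F≡0 (sym at-1))
  ... | inj₂ (inj₂ (F≡1 , G≡0)) | at-1 = ⊥-elim (unique-vs-none p-injective q-injective k F≡1 G≡0 at-1)

open Combinatorics

module Traces {c ℓ} (K : ACField₀ c ℓ) where
  open ACField₀ K hiding (zero) renaming (refl to ≈-refl; sym to ≈-sym; trans to ≈-trans; reflexive to ≈-reflexive)
  open Matrices K
  open SemiringSum semiring
    using (sum; sum-syntax; sum-cong-≋; ∑-comm; ∑-distrib-+; *-distribˡ-sum; *-distribʳ-sum; sum-replicate-zero)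
  open SemiringMult semiring using (×-homo-+; ×1-homo-*) renaming (_×_ to _×′_)
  open GroupProperties +-group using (∙-cancelˡ; ∙-cancelʳ)

  module ≈-Reasoning = SetoidReasoning setoid

  ⟦_⟧ : ∀ {a} {A : Set a} → Dec A → Carrier
  ⟦ a? ⟧ = if does a? then 1# else 0#

  δ : Fin n → Fin n → Carrier
  δ i j = ⟦ i ≟ j ⟧

  δ₂ : Fin n × Fin n → Fin n × Fin n → Carrier
  δ₂ (i , j) (k , l) = δ i k * δ j l

  natCast≡×1 : ∀ m → natCast m ≡ m ×′ 1#
  natCast≡×1 zero    = refl
  natCast≡×1 (suc m) = cong (1# +_) (natCast≡×1 m)

  natCast-+ : ∀ a b → natCast (a ℕ.+ b) ≈ natCast a + natCast b
  natCast-+ a b = begin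
    natCast (a ℕ.+ b)      ≡⟨ natCast≡×1 (a ℕ.+ b) ⟩
    (a ℕ.+ b) ×′ 1#        ≈⟨ ×-homo-+ 1# a b ⟩
    a ×′ 1# + b ×′ 1#      ≡⟨ cong₂ _+_ (natCast≡×1 a) (natCast≡×1 b) ⟨
    natCast a + natCast b  ∎
    where open ≈-Reasoning

  natCast-* : ∀ a b → natCast (a ℕ.* b) ≈ natCast a * natCast b
  natCast-* a b = begin
    natCast (a ℕ.* b)      ≡⟨ natCast≡×1 (a ℕ.* b) ⟩
    (a ℕ.* b) ×′ 1#        ≈⟨ ×1-homo-* a b ⟩
    a ×′ 1# * b ×′ 1#      ≡⟨ cong₂ _*_ (natCast≡×1 a) (natCast≡×1 b) ⟨
    natCast a * natCast b  ∎
    where open ≈-Reasoning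

  natCast-injective : ∀ {a b} → natCast a ≈ natCast b → a ≡ b
  natCast-injective {zero}  {zero}  _ = refl
  natCast-injective {zero}  {suc b} e = contradiction (≈-sym e) (characteristic0 b)
  natCast-injective {suc a} {zero}  e = contradiction e (characteristic0 a)
  natCast-injective {suc a} {suc b} e = cong suc (natCast-injective (∙-cancelˡ 1# _ _ e))

  ∑⟦⟧≈count : {P : Pred (Fin n) 0ℓ} (P? : Decidable P) → ∑[ i < n ] ⟦ P? i ⟧ ≈ natCast (count P?)
  ∑⟦⟧≈count {zero}  P? = ≈-refl
  ∑⟦⟧≈count {suc n} P? with P? zero
  ... | yes _ = +-congˡ (∑⟦⟧≈count (P? ∘ suc))
  ... | no _  = ≈-trans (+-identityˡ _) (∑⟦⟧≈count (P? ∘ suc))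

  ∑-0 : {f : Fin n → Carrier} → (∀ i → f i ≈ 0#) → sum f ≈ 0#
  ∑-0 {n} f≈0 = ≈-trans (sum-cong-≋ {n} f≈0) (sum-replicate-zero n)

  ∑-δ : (a : Fin n) (f : Fin n → Carrier) → ∑[ i < n ] (δ a i * f i) ≈ f a
  ∑-δ {suc n} zero f = begin
    1# * f zero + ∑[ i < n ] (0# * f (suc i))  ≈⟨ +-cong (*-identityˡ _) (∑-0 {n} (λ i → zeroˡ (f (suc i)))) ⟩
    f zero + 0#                                ≈⟨ +-identityʳ _ ⟩
    f zero                                     ∎
    where open ≈-Reasoning
  ∑-δ {suc n} (suc a) f = ≈-trans (+-cong (zeroˡ _) (∑-δ a (f ∘ suc))) (+-identityˡ _)

  δ-comm : (i j : Fin n) → δ i j ≈ δ j i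
  δ-comm i j with i ≟ j | j ≟ i
  ... | yes _   | yes _   = ≈-refl
  ... | no _    | no _    = ≈-refl
  ... | yes i≡j | no j≢i  = contradiction (sym i≡j) j≢i
  ... | no i≢j  | yes j≡i = contradiction (sym j≡i) i≢j

  δ₂-comm : (u v : Fin n × Fin n) → δ₂ u v ≈ δ₂ v u
  δ₂-comm (i , j) (k , l) = *-cong (δ-comm i k) (δ-comm j l)

  ⟦⟧-pair : {i j k l : Fin n} (d : Dec ((i , j) ≡ (k , l))) → ⟦ d ⟧ ≈ δ₂ (i , j) (k , l)
  ⟦⟧-pair {i = i} {j} {k} {l} d with i ≟ k | j ≟ l | d
  ... | yes refl | yes refl | yes _    = ≈-sym (*-identityˡ 1#)
  ... | yes refl | yes refl | no ne    = contradiction refl ne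
  ... | no i≢k   | _        | yes refl = contradiction refl i≢k
  ... | yes _    | no j≢l   | yes refl = contradiction refl j≢l
  ... | no _     | _        | no _     = ≈-sym (zeroˡ _)
  ... | yes _    | no _     | no _     = ≈-sym (zeroʳ _)

  identity≈δ₂ : (x y : Pair₂ n) → identity x y ≈ δ₂ (proj₁ x) (proj₁ y)
  identity≈δ₂ x y = ≈-trans as-bracket (⟦⟧-pair (pairEq? x y))
    where
    as-bracket : identity x y ≈ ⟦ pairEq? x y ⟧
    as-bracket with pairEq? x y
    ... | yes _ = ≈-refl
    ... | no _  = ≈-refl

  permMatrix : (Fin n → Fin n) → Mat₂ n
  permMatrix f x y = δ₂ (Product.map f f (proj₁ y)) (proj₁ x)

  ρ₂≋permMatrix : (π : Permutation′ n) → ρ₂ π ≋ permMatrix (π ⟨$⟩ʳ_)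
  ρ₂≋permMatrix π x y = ≈-trans as-bracket (⟦⟧-pair (pairEq? (act₂ π y) x))
    where
    as-bracket : ρ₂ π x y ≈ ⟦ pairEq? (act₂ π y) x ⟧
    as-bracket with pairEq? (act₂ π y) x
    ... | yes _ = ≈-refl
    ... | no _  = ≈-refl

  extend : (Pair₂ n → Carrier) → Fin n → Fin n → Carrier
  extend f i j with i ≟ j
  ... | yes _   = 0#
  ... | no i≢j  = f ((i , j) , i≢j)

  -- The summand of sumPair₂ f is local to its definition; unification names it here, so that
  -- `with` can compare it with extend f.
  sumPair₂-summand : (f : Pair₂ n → Carrier) →
                     ∃ λ (s : Fin n → Fin n → Carrier) → sumPair₂ f ≡ sumFin (λ i → sumFin (s i))
  sumPair₂-summand f = _ , refl

  sumFin≡sum : (f : Fin n → Carrier) → sumFin f ≡ sum f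
  sumFin≡sum {zero}  f = refl
  sumFin≡sum {suc n} f = cong (f zero +_) (sumFin≡sum (f ∘ suc))

  sumPair₂≈∑∑ : (f : Pair₂ n → Carrier) → sumPair₂ f ≈ ∑[ i < n ] ∑[ j < n ] extend f i j
  sumPair₂≈∑∑ {n} f = begin
    sumPair₂ f                          ≡⟨ proj₂ (sumPair₂-summand f) ⟩
    sumFin (λ i → sumFin (s i))         ≡⟨ sumFin≡sum (λ i → sumFin (s i)) ⟩
    ∑[ i < n ] sumFin (s i)             ≈⟨ sum-cong-≋ {n} (λ i → ≈-reflexive (sumFin≡sum (s i))) ⟩
    ∑[ i < n ] ∑[ j < n ] s i j         ≈⟨ sum-cong-≋ {n} (λ i → sum-cong-≋ {n} (s≈extend i)) ⟩
    ∑[ i < n ] ∑[ j < n ] extend f i j  ∎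
    where
    open ≈-Reasoning
    s : Fin n → Fin n → Carrier
    s = proj₁ (sumPair₂-summand f)
    s≈extend : ∀ i j → s i j ≈ extend f i j
    s≈extend i j with i ≟ j
    ... | yes _ = ≈-refl
    ... | no _  = ≈-refl

  ∑∑-cong : {f g : Fin n → Fin n → Carrier} → (∀ i j → f i j ≈ g i j) →
            ∑[ i < n ] ∑[ j < n ] f i j ≈ ∑[ i < n ] ∑[ j < n ] g i j
  ∑∑-cong {n} f≈g = sum-cong-≋ {n} (λ i → sum-cong-≋ {n} (f≈g i))

  sumPair₂-cong : {f g : Pair₂ n → Carrier} → (∀ z → f z ≈ g z) → sumPair₂ f ≈ sumPair₂ g
  sumPair₂-cong {f = f} {g} f≈g = ≈-trans (sumPair₂≈∑∑ f) (≈-trans (∑∑-cong on-pairs) (≈-sym (sumPair₂≈∑∑ g)))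
    where
    on-pairs : ∀ i j → extend f i j ≈ extend g i j
    on-pairs i j with i ≟ j
    ... | yes _ = ≈-refl
    ... | no _  = f≈g _

  *-distribˡ-sumPair₂ : ∀ x (f : Pair₂ n → Carrier) → x * sumPair₂ f ≈ sumPair₂ (λ z → x * f z)
  *-distribˡ-sumPair₂ {n} x f = begin
    x * sumPair₂ f                               ≈⟨ *-congˡ (sumPair₂≈∑∑ f) ⟩
    x * ∑[ i < n ] ∑[ j < n ] extend f i j       ≈⟨ *-distribˡ-sum x (λ i → ∑[ j < n ] extend f i j) ⟩
    ∑[ i < n ] (x * ∑[ j < n ] extend f i j)     ≈⟨ sum-cong-≋ {n} (λ i → *-distribˡ-sum x (extend f i)) ⟩
    ∑[ i < n ] ∑[ j < n ] (x * extend f i j)     ≈⟨ ∑∑-cong on-pairs ⟩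
    ∑[ i < n ] ∑[ j < n ] extend (λ z → x * f z) i j ≈⟨ sumPair₂≈∑∑ (λ z → x * f z) ⟨
    sumPair₂ (λ z → x * f z)                     ∎
    where
    open ≈-Reasoning
    on-pairs : ∀ i j → x * extend f i j ≈ extend (λ z → x * f z) i j
    on-pairs i j with i ≟ j
    ... | yes _ = zeroʳ x
    ... | no _  = ≈-refl

  *-distribʳ-sumPair₂ : ∀ x (f : Pair₂ n → Carrier) → sumPair₂ f * x ≈ sumPair₂ (λ z → f z * x)
  *-distribʳ-sumPair₂ x f =
    ≈-trans (*-comm _ x) (≈-trans (*-distribˡ-sumPair₂ x f) (sumPair₂-cong (λ z → *-comm x (f z))))

  ∑∑∑∑-comm : (G : Fin n → Fin n → Fin n → Fin n → Carrier) →
              ∑[ i < n ] ∑[ j < n ] ∑[ k < n ] ∑[ l < n ] G i j k l ≈ ∑[ k < n ] ∑[ l < n ] ∑[ i < n ] ∑[ j < n ] G i j k l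
  ∑∑∑∑-comm {n} G = begin
    ∑[ i < n ] ∑[ j < n ] ∑[ k < n ] ∑[ l < n ] G i j k l  ≈⟨ sum-cong-≋ {n} (λ i → ∑-comm (λ j k → ∑[ l < n ] G i j k l)) ⟩
    ∑[ i < n ] ∑[ k < n ] ∑[ j < n ] ∑[ l < n ] G i j k l  ≈⟨ ∑-comm (λ i k → ∑[ j < n ] ∑[ l < n ] G i j k l) ⟩
    ∑[ k < n ] ∑[ i < n ] ∑[ j < n ] ∑[ l < n ] G i j k l  ≈⟨ ∑∑-cong (λ k i → ∑-comm (λ j l → G i j k l)) ⟩
    ∑[ k < n ] ∑[ i < n ] ∑[ l < n ] ∑[ j < n ] G i j k l  ≈⟨ sum-cong-≋ {n} (λ k → ∑-comm (λ i l → ∑[ j < n ] G i j k l)) ⟩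
    ∑[ k < n ] ∑[ l < n ] ∑[ i < n ] ∑[ j < n ] G i j k l  ∎
    where open ≈-Reasoning

  sumPair₂-nested : (F : Pair₂ n → Pair₂ n → Carrier) → sumPair₂ (λ z → sumPair₂ (F z)) ≈
                    ∑[ i < n ] ∑[ j < n ] ∑[ k < n ] ∑[ l < n ] extend (λ z → extend (F z) k l) i j
  sumPair₂-nested {n} F = ≈-trans (sumPair₂≈∑∑ (λ z → sumPair₂ (F z))) (∑∑-cong on-pairs)
    where
    on-pairs : ∀ i j → extend (λ z → sumPair₂ (F z)) i j ≈ ∑[ k < n ] ∑[ l < n ] extend (λ z → extend (F z) k l) i j
    on-pairs i j with i ≟ j
    ... | yes _   = ≈-sym (∑-0 {n} (λ k → ∑-0 {n} (λ l → ≈-refl)))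
    ... | no i≢j  = sumPair₂≈∑∑ (F ((i , j) , i≢j))

  sumPair₂-comm : (F : Pair₂ n → Pair₂ n → Carrier) →
                  sumPair₂ (λ z → sumPair₂ (F z)) ≈ sumPair₂ (λ w → sumPair₂ (λ z → F z w))
  sumPair₂-comm {n} F = begin
    sumPair₂ (λ z → sumPair₂ (F z))
      ≈⟨ sumPair₂-nested F ⟩
    ∑[ i < n ] ∑[ j < n ] ∑[ k < n ] ∑[ l < n ] extend (λ z → extend (F z) k l) i j
      ≈⟨ ∑∑∑∑-comm (λ i j k l → extend (λ z → extend (F z) k l) i j) ⟩
    ∑[ k < n ] ∑[ l < n ] ∑[ i < n ] ∑[ j < n ] extend (λ z → extend (F z) k l) i j
      ≈⟨ ∑∑-cong (λ k l → ∑∑-cong (λ i j → extend-swap i j k l)) ⟩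
    ∑[ k < n ] ∑[ l < n ] ∑[ i < n ] ∑[ j < n ] extend (λ w → extend (λ z → F z w) i j) k l
      ≈⟨ sumPair₂-nested (λ w z → F z w) ⟨
    sumPair₂ (λ w → sumPair₂ (λ z → F z w)) ∎
    where
    open ≈-Reasoning
    extend-swap : ∀ i j k l → extend (λ z → extend (F z) k l) i j ≈ extend (λ w → extend (λ z → F z w) i j) k l
    extend-swap i j k l with i ≟ j | k ≟ l
    ... | yes _ | yes _ = ≈-refl
    ... | yes _ | no _  = ≈-refl
    ... | no _  | yes _ = ≈-refl
    ... | no _  | no _  = ≈-refl

  sumPair₂-sift : ∀ {a b : Fin n} → a ≢ b → (G : Fin n × Fin n → Carrier) →
                  sumPair₂ (λ z → G (proj₁ z) * δ₂ (a , b) (proj₁ z)) ≈ G (a , b)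
  sumPair₂-sift {n} {a} {b} a≢b G = begin
    sumPair₂ (λ z → G (proj₁ z) * δ₂ (a , b) (proj₁ z))
      ≈⟨ sumPair₂≈∑∑ (λ z → G (proj₁ z) * δ₂ (a , b) (proj₁ z)) ⟩
    ∑[ i < n ] ∑[ j < n ] extend (λ z → G (proj₁ z) * δ₂ (a , b) (proj₁ z)) i j
      ≈⟨ ∑∑-cong on-pairs ⟩
    ∑[ i < n ] ∑[ j < n ] (δ a i * (δ b j * G (i , j)))
      ≈⟨ sum-cong-≋ {n} (λ i → *-distribˡ-sum (δ a i) (λ j → δ b j * G (i , j))) ⟨
    ∑[ i < n ] (δ a i * ∑[ j < n ] (δ b j * G (i , j)))
      ≈⟨ sum-cong-≋ {n} (λ i → *-congˡ (∑-δ b (λ j → G (i , j)))) ⟩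
    ∑[ i < n ] (δ a i * G (i , b))
      ≈⟨ ∑-δ a (λ i → G (i , b)) ⟩
    G (a , b) ∎
    where
    open ≈-Reasoning
    diagonal-vanishes : ∀ i → δ a i * (δ b i * G (i , i)) ≈ 0#
    diagonal-vanishes i with a ≟ i | b ≟ i
    ... | yes refl | yes refl = contradiction refl a≢b
    ... | no _       | _          = zeroˡ _
    ... | yes _      | no _       = ≈-trans (*-identityˡ _) (zeroˡ _)
    on-pairs : ∀ i j → extend (λ z → G (proj₁ z) * δ₂ (a , b) (proj₁ z)) i j ≈ δ a i * (δ b j * G (i , j))
    on-pairs i j with i ≟ j
    ... | yes refl = ≈-sym (diagonal-vanishes i)
    ... | no _       = ≈-trans (*-comm _ _) (*-assoc _ _ _)

  sumPair₂+diagonal : (G : Fin n × Fin n → Carrier) →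
                      sumPair₂ (G ∘ proj₁) + ∑[ i < n ] G (i , i) ≈ ∑[ i < n ] ∑[ j < n ] G (i , j)
  sumPair₂+diagonal {n} G = begin
    sumPair₂ (G ∘ proj₁) + ∑[ i < n ] G (i , i)
      ≈⟨ +-cong (sumPair₂≈∑∑ (G ∘ proj₁)) (≈-sym (sum-cong-≋ {n} (λ i → ∑-δ i (λ j → G (i , j))))) ⟩
    ∑[ i < n ] ∑[ j < n ] extend (G ∘ proj₁) i j + ∑[ i < n ] ∑[ j < n ] (δ i j * G (i , j))
      ≈⟨ ∑-distrib-+ (λ i → ∑[ j < n ] extend (G ∘ proj₁) i j) (λ i → ∑[ j < n ] (δ i j * G (i , j))) ⟨
    ∑[ i < n ] (∑[ j < n ] extend (G ∘ proj₁) i j + ∑[ j < n ] (δ i j * G (i , j)))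
      ≈⟨ sum-cong-≋ {n} (λ i → ∑-distrib-+ (extend (G ∘ proj₁) i) (λ j → δ i j * G (i , j))) ⟨
    ∑[ i < n ] ∑[ j < n ] (extend (G ∘ proj₁) i j + δ i j * G (i , j))
      ≈⟨ ∑∑-cong split ⟩
    ∑[ i < n ] ∑[ j < n ] G (i , j) ∎
    where
    open ≈-Reasoning
    split : ∀ i j → extend (G ∘ proj₁) i j + δ i j * G (i , j) ≈ G (i , j)
    split i j with i ≟ j
    ... | yes _ = ≈-trans (+-identityˡ _) (*-identityˡ _)
    ... | no _  = ≈-trans (+-congˡ (zeroˡ _)) (+-identityʳ _)

  ≋-refl : {A : Mat₂ n} → A ≋ A
  ≋-refl _ _ = ≈-refl

  ≋-sym : {A B : Mat₂ n} → A ≋ B → B ≋ A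
  ≋-sym A≋B x y = ≈-sym (A≋B x y)

  ≋-trans : {A B C : Mat₂ n} → A ≋ B → B ≋ C → A ≋ C
  ≋-trans A≋B B≋C x y = ≈-trans (A≋B x y) (B≋C x y)

  ≋-setoid : ℕ → Setoid c ℓ
  ≋-setoid n = record
    { Carrier       = Mat₂ n
    ; _≈_           = _≋_
    ; isEquivalence = record { refl = ≋-refl ; sym = ≋-sym ; trans = ≋-trans }
    }

  module ≋-Reasoning {n} = SetoidReasoning (≋-setoid n)

  ⊛-cong : {A A′ B B′ : Mat₂ n} → A ≋ A′ → B ≋ B′ → (A ⊛ B) ≋ (A′ ⊛ B′)
  ⊛-cong A≋A′ B≋B′ x y = sumPair₂-cong (λ z → *-cong (A≋A′ x z) (B≋B′ z y))

  ⊛-assoc : (A B C : Mat₂ n) → ((A ⊛ B) ⊛ C) ≋ (A ⊛ (B ⊛ C))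
  ⊛-assoc A B C x y = begin
    sumPair₂ (λ z → sumPair₂ (λ w → A x w * B w z) * C z y)
      ≈⟨ sumPair₂-cong (λ z → *-distribʳ-sumPair₂ (C z y) (λ w → A x w * B w z)) ⟩
    sumPair₂ (λ z → sumPair₂ (λ w → (A x w * B w z) * C z y))
      ≈⟨ sumPair₂-comm (λ z w → (A x w * B w z) * C z y) ⟩
    sumPair₂ (λ w → sumPair₂ (λ z → (A x w * B w z) * C z y))
      ≈⟨ sumPair₂-cong (λ w → sumPair₂-cong (λ z → *-assoc (A x w) (B w z) (C z y))) ⟩
    sumPair₂ (λ w → sumPair₂ (λ z → A x w * (B w z * C z y)))
      ≈⟨ sumPair₂-cong (λ w → *-distribˡ-sumPair₂ (A x w) (λ z → B w z * C z y)) ⟨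
    sumPair₂ (λ w → A x w * sumPair₂ (λ z → B w z * C z y)) ∎
    where open ≈-Reasoning

  trace : Mat₂ n → Carrier
  trace M = sumPair₂ (λ x → M x x)

  trace-cong : {A B : Mat₂ n} → A ≋ B → trace A ≈ trace B
  trace-cong A≋B = sumPair₂-cong (λ x → A≋B x x)

  trace-⊛-comm : (A B : Mat₂ n) → trace (A ⊛ B) ≈ trace (B ⊛ A)
  trace-⊛-comm A B = ≈-trans (sumPair₂-comm (λ x z → A x z * B z x))
                             (sumPair₂-cong (λ z → sumPair₂-cong (λ x → *-comm (A x z) (B z x))))

  -- Powers start from the first because a matrix over Pair₂ may depend on the proofs of i ≢ j in
  -- its indices, so identity is only known to be a right unit for matrices such as permMatrix f,
  -- whose entries depend on coordinates alone.
  infix 25 _^[1+_]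
  _^[1+_] : Mat₂ n → ℕ → Mat₂ n
  M ^[1+ zero  ] = M
  M ^[1+ suc k ] = M ⊛ M ^[1+ k ]

  ^[1+]-cong : {A B : Mat₂ n} → A ≋ B → ∀ k → A ^[1+ k ] ≋ B ^[1+ k ]
  ^[1+]-cong A≋B zero    = A≋B
  ^[1+]-cong A≋B (suc k) = ⊛-cong A≋B (^[1+]-cong A≋B k)

  ^[1+]-identityʳ : {A : Mat₂ n} → (A ⊛ identity) ≋ A → ∀ k → (A ^[1+ k ] ⊛ identity) ≋ A ^[1+ k ]
  ^[1+]-identityʳ         AI≋A zero    = AI≋A
  ^[1+]-identityʳ {A = A} AI≋A (suc k) =
    ≋-trans (⊛-assoc A (A ^[1+ k ]) identity) (⊛-cong ≋-refl (^[1+]-identityʳ AI≋A k))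

  conjugate-^[1+] : {A B P Q : Mat₂ n} → (A ⊛ identity) ≋ A → (Q ⊛ P) ≋ identity → ((P ⊛ A) ⊛ Q) ≋ B →
                    ∀ k → B ^[1+ k ] ≋ ((P ⊛ A ^[1+ k ]) ⊛ Q)
  conjugate-^[1+] AI≋A QP≋I PAQ≋B zero = ≋-sym PAQ≋B
  conjugate-^[1+] {n} {A} {B} {P} {Q} AI≋A QP≋I PAQ≋B (suc k) = begin
    B ⊛ B ^[1+ k ]                                ≈⟨ ⊛-cong (≋-sym PAQ≋B) (conjugate-^[1+] AI≋A QP≋I PAQ≋B k) ⟩
    ((P ⊛ A) ⊛ Q) ⊛ ((P ⊛ Aᵏ) ⊛ Q)                ≈⟨ ⊛-assoc (P ⊛ A) Q ((P ⊛ Aᵏ) ⊛ Q) ⟩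
    (P ⊛ A) ⊛ (Q ⊛ ((P ⊛ Aᵏ) ⊛ Q))                ≈⟨ ⊛-cong ≋-refl (⊛-assoc Q (P ⊛ Aᵏ) Q) ⟨
    (P ⊛ A) ⊛ ((Q ⊛ (P ⊛ Aᵏ)) ⊛ Q)                ≈⟨ ⊛-cong ≋-refl (⊛-cong (⊛-assoc Q P Aᵏ) ≋-refl) ⟨
    (P ⊛ A) ⊛ (((Q ⊛ P) ⊛ Aᵏ) ⊛ Q)                ≈⟨ ⊛-cong ≋-refl (⊛-cong (⊛-cong QP≋I ≋-refl) ≋-refl) ⟩
    (P ⊛ A) ⊛ ((identity ⊛ Aᵏ) ⊛ Q)               ≈⟨ ⊛-assoc P A ((identity ⊛ Aᵏ) ⊛ Q) ⟩
    P ⊛ (A ⊛ ((identity ⊛ Aᵏ) ⊛ Q))               ≈⟨ ⊛-cong ≋-refl (⊛-assoc A (identity ⊛ Aᵏ) Q) ⟨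
    P ⊛ ((A ⊛ (identity ⊛ Aᵏ)) ⊛ Q)               ≈⟨ ⊛-cong ≋-refl (⊛-cong (⊛-assoc A identity Aᵏ) ≋-refl) ⟨
    P ⊛ (((A ⊛ identity) ⊛ Aᵏ) ⊛ Q)               ≈⟨ ⊛-cong ≋-refl (⊛-cong (⊛-cong AI≋A ≋-refl) ≋-refl) ⟩
    P ⊛ ((A ⊛ Aᵏ) ⊛ Q)                            ≈⟨ ⊛-assoc P (A ⊛ Aᵏ) Q ⟨
    (P ⊛ (A ⊛ Aᵏ)) ⊛ Q                            ∎
    where
    open ≋-Reasoning
    Aᵏ : Mat₂ n
    Aᵏ = A ^[1+ k ]

  similar⇒trace-^[1+] : {A B : Mat₂ n} → (A ⊛ identity) ≋ A → Similar A B → ∀ k → trace (B ^[1+ k ]) ≈ trace (A ^[1+ k ])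
  similar⇒trace-^[1+] {A = A} {B} AI≋A (P , Q , _ , QP≋I , PAQ≋B) k = begin
    trace (B ^[1+ k ])                 ≈⟨ trace-cong (conjugate-^[1+] AI≋A QP≋I PAQ≋B k) ⟩
    trace ((P ⊛ A ^[1+ k ]) ⊛ Q)       ≈⟨ trace-⊛-comm (P ⊛ A ^[1+ k ]) Q ⟩
    trace (Q ⊛ (P ⊛ A ^[1+ k ]))       ≈⟨ trace-cong (⊛-assoc Q P (A ^[1+ k ])) ⟨
    trace ((Q ⊛ P) ⊛ A ^[1+ k ])       ≈⟨ trace-cong (⊛-cong QP≋I ≋-refl) ⟩
    trace (identity ⊛ A ^[1+ k ])      ≈⟨ trace-⊛-comm identity (A ^[1+ k ]) ⟩
    trace (A ^[1+ k ] ⊛ identity)      ≈⟨ trace-cong (^[1+]-identityʳ AI≋A k) ⟩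
    trace (A ^[1+ k ])                 ∎
    where open ≈-Reasoning

  permMatrix-⊛ : (f g : Fin n → Fin n) → Injective _≡_ _≡_ g → (permMatrix f ⊛ permMatrix g) ≋ permMatrix (f ∘ g)
  permMatrix-⊛ f g g-injectiveective x y =
    sumPair₂-sift (proj₂ y ∘ g-injectiveective) (λ u → δ₂ (Product.map f f u) (proj₁ x))

  permMatrix-identityʳ : (f : Fin n → Fin n) → (permMatrix f ⊛ identity) ≋ permMatrix f
  permMatrix-identityʳ f x y = ≈-trans
    (sumPair₂-cong (λ z → *-congˡ (≈-trans (identity≈δ₂ z y) (δ₂-comm (proj₁ z) (proj₁ y)))))
    (sumPair₂-sift (proj₂ y) (λ u → δ₂ (Product.map f f u) (proj₁ x)))

  permMatrix-^[1+] : (f : Fin n → Fin n) → Injective _≡_ _≡_ f → ∀ k → permMatrix f ^[1+ k ] ≋ permMatrix (f ^ suc k)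
  permMatrix-^[1+] f f-injective zero    = ≋-refl
  permMatrix-^[1+] f f-injective (suc k) = ≋-trans (⊛-cong ≋-refl (permMatrix-^[1+] f f-injective k))
    (permMatrix-⊛ f (f ^ suc k) (Periods.^-injective f f-injective (suc k)))

  ⟦⟧-idem : ∀ {a} {A : Set a} (a? : Dec A) → ⟦ a? ⟧ * ⟦ a? ⟧ ≈ ⟦ a? ⟧
  ⟦⟧-idem a? with does a?
  ... | true  = *-identityˡ 1#
  ... | false = zeroˡ 0#

  trace-permMatrix : (f : Fin n → Fin n) → trace (permMatrix f) ≈ natCast (pairCount (fixCount f))
  trace-permMatrix {n} f = ∙-cancelʳ (natCast F) (trace (permMatrix f)) (natCast (pairCount F)) (begin
    trace (permMatrix f) + natCast F
      ≈⟨ +-congˡ (≈-trans (sum-cong-≋ {n} (λ i → ⟦⟧-idem (fix? f i))) (∑⟦⟧≈count (fix? f))) ⟨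
    trace (permMatrix f) + ∑[ i < n ] (e i * e i)       ≈⟨ sumPair₂+diagonal (λ (i , j) → e i * e j) ⟩
    ∑[ i < n ] ∑[ j < n ] (e i * e j)                   ≈⟨ sum-cong-≋ {n} (λ i → *-distribˡ-sum (e i) e) ⟨
    ∑[ i < n ] (e i * ∑[ j < n ] e j)                   ≈⟨ *-distribʳ-sum (∑[ j < n ] e j) e ⟨
    (∑[ i < n ] e i) * (∑[ j < n ] e j)                 ≈⟨ *-cong (∑⟦⟧≈count (fix? f)) (∑⟦⟧≈count (fix? f)) ⟩
    natCast F * natCast F                               ≈⟨ natCast-* F F ⟨
    natCast (F ℕ.* F)                                   ≡⟨ cong natCast (pairCount-+ F) ⟨
    natCast (pairCount F ℕ.+ F)                         ≈⟨ natCast-+ (pairCount F) F ⟩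
    natCast (pairCount F) + natCast F                   ∎)
    where
    open ≈-Reasoning
    F : ℕ
    F = fixCount f
    e : Fin n → Carrier
    e i = ⟦ fix? f i ⟧

  ρ₂-identityʳ : (π : Permutation′ n) → (ρ₂ π ⊛ identity) ≋ ρ₂ π
  ρ₂-identityʳ π = ≋-trans (⊛-cong (ρ₂≋permMatrix π) ≋-refl)
                           (≋-trans (permMatrix-identityʳ (π ⟨$⟩ʳ_)) (≋-sym (ρ₂≋permMatrix π)))

  trace-ρ₂-^[1+] : (π : Permutation′ n) →
                   ∀ k → trace (ρ₂ π ^[1+ k ]) ≈ natCast (pairCount (fixCount ((π ⟨$⟩ʳ_) ^ suc k)))
  trace-ρ₂-^[1+] π k = begin
    trace (ρ₂ π ^[1+ k ])                          ≈⟨ trace-cong (^[1+]-cong (ρ₂≋permMatrix π) k) ⟩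
    trace (permMatrix (π ⟨$⟩ʳ_) ^[1+ k ])          ≈⟨ trace-cong (permMatrix-^[1+] (π ⟨$⟩ʳ_) (⟨$⟩ʳ-injective π) k) ⟩
    trace (permMatrix ((π ⟨$⟩ʳ_) ^ suc k))         ≈⟨ trace-permMatrix ((π ⟨$⟩ʳ_) ^ suc k) ⟩
    natCast (pairCount (fixCount ((π ⟨$⟩ʳ_) ^ suc k))) ∎
    where open ≈-Reasoning

  similar⇒samePairCounts : {π σ : Permutation′ n} → Similar (ρ₂ π) (ρ₂ σ) → SamePairCounts (π ⟨$⟩ʳ_) (σ ⟨$⟩ʳ_)
  similar⇒samePairCounts sim zero = refl
  similar⇒samePairCounts {π = π} {σ} sim (suc k) = natCast-injective (begin
    natCast (pairCount (fixCount ((π ⟨$⟩ʳ_) ^ suc k)))  ≈⟨ trace-ρ₂-^[1+] π k ⟨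
    trace (ρ₂ π ^[1+ k ])                               ≈⟨ similar⇒trace-^[1+] (ρ₂-identityʳ π) sim k ⟨
    trace (ρ₂ σ ^[1+ k ])                               ≈⟨ trace-ρ₂-^[1+] σ k ⟩
    natCast (pairCount (fixCount ((σ ⟨$⟩ʳ_) ^ suc k)))  ∎)
    where open ≈-Reasoning

theorem3p9 : ∀ {c ℓ : Level} (K : ACField₀ c ℓ) (n : ℕ) → 2 ≤ n →
    (π σ : Permutation′ n) →
    Matrices.Similar K (Matrices.ρ₂ K π) (Matrices.ρ₂ K σ) →
    Conjugate π σ
theorem3p9 K n n≥2 π σ similar =
  Conjugacies.conjugator (⟨$⟩ʳ-injective π) (⟨$⟩ʳ-injective σ)
    (fixCounts-equal n≥2 (⟨$⟩ʳ-injective π) (⟨$⟩ʳ-injective σ) (Traces.similar⇒samePairCounts K similar))
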